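{- Let $G$ be a finite group, $\Gamma_G$ its power graph, and let $p$ be a prime dividing $|G|$. If $\mathrm{rc}(\Gamma_G)=2$, then $G$ has exactly one subgroup of order $p$.
   Context: For a finite group $G$ with identity $e$, the power graph $\Gamma_G$ is the undirected graph with vertex set $G$ in which two distinct elements are adjacent if one is a power of the other. For a connected graph $\Gamma$, an edge coloring $\zeta:E(\Gamma)\to\{1,\dots,k\}$ (adjacent edges may receive the same color) is a rainbow $k$-coloring if every pair of vertices is joined by a path whose edges have pairwise distinct colors; the rainbow connection number $\mathrm{rc}(\Gamma)$ is the minimum $k$ for which a rainbow $k$-coloring exists. -}

module Defs where

open import Data.Nat using (ℕ; zero; suc)
open import Data.Fin using (Fin)
open import Data.Fin.Subset using (Subset; _∈_; ∣_∣)
open import Data.List using (List; []; _∷_; map)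
open import Data.List.Relation.Unary.Unique.Propositional using (Unique)
open import Data.Product using (Σ; ∃; _×_; _,_)
open import Data.Sum using (_⊎_)
open import Relation.Nullary using (¬_)
open import Relation.Binary.PropositionalEquality using (_≡_)
open import Algebra.Structures using (IsGroup)

-- A finite group of order n: a group structure on Fin n
-- (every finite group is isomorphic to one of this form).
record FinGroup (n : ℕ) : Set where
  field
    _∙_ : Fin n → Fin n → Fin n
    ε   : Fin n
    _⁻¹ : Fin n → Fin n
    isGroup : IsGroup _≡_ _∙_ ε _⁻¹

module _ {n : ℕ} (G : FinGroup n) where
  open FinGroup G

  pow : Fin n → ℕ → Fin n
  pow x zero    = ε
  pow x (suc k) = x ∙ pow x k

  PowAdj : Fin n → Fin n → Set
  PowAdj x y = ¬ (x ≡ y) × ((∃ λ k → y ≡ pow x k) ⊎ (∃ λ k → x ≡ pow y k))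

  -- a path in Γ_G from u to v, given as its list of vertices
  -- u = v₀, v₁, …, v_m = v (pairwise distinct, consecutive ones adjacent)
  data Walk : Fin n → Fin n → List (Fin n) → Set where
    here : ∀ v → Walk v v (v ∷ [])
    step : ∀ {u w v vs} → PowAdj u w → Walk w v vs → Walk u v (u ∷ vs)

  edgeColours : {k : ℕ} → (Fin n → Fin n → Fin k) → List (Fin n) → List (Fin k)
  edgeColours c []            = []
  edgeColours c (x ∷ [])      = []
  edgeColours c (x ∷ y ∷ vs)  = c x y ∷ edgeColours c (y ∷ vs)

  -- an edge colouring with k colours: colours on (unordered) edges,
  -- i.e. a symmetric function (its values on non-edges are irrelevant)
  IsEdgeColouring : {k : ℕ} → (Fin n → Fin n → Fin k) → Set
  IsEdgeColouring c = ∀ x y → PowAdj x y → c x y ≡ c y x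

  IsRainbowColouring : (k : ℕ) → (Fin n → Fin n → Fin k) → Set
  IsRainbowColouring k c =
    IsEdgeColouring c ×
    (∀ u v → ∃ λ vs → Walk u v vs × Unique vs × Unique (edgeColours c vs))

  HasRainbowColouring : ℕ → Set
  HasRainbowColouring k = ∃ λ (c : Fin n → Fin n → Fin k) → IsRainbowColouring k c

  RainbowConnectionNumber : ℕ → Set
  RainbowConnectionNumber k =
    HasRainbowColouring k × (∀ j → suc j Data.Nat.≤ k → ¬ HasRainbowColouring j)

  IsSubgroup : Subset n → Set
  IsSubgroup S = (ε ∈ S) × (∀ x y → x ∈ S → y ∈ S → (x ∙ y) ∈ S) × (∀ x → x ∈ S → (x ⁻¹) ∈ S)

  UniqueSubgroupOfOrder : ℕ → Set
  UniqueSubgroupOfOrder m =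
    Σ (Subset n) λ H → (IsSubgroup H × ∣ H ∣ ≡ m) ×
      (∀ K → IsSubgroup K → ∣ K ∣ ≡ m → K ≡ H)

module Submission where

-- Write x ∈⟨ g ⟩ for "x is a power of g".
-- Finally, if b ∉⟨ a ⟩ for a, b of order p, the solutions of x ^ p = ε would be
-- ⟨ a ⟩ and the p - 1 nontrivial powers of b, 2p - 1 in all, contradicting
-- McKay.  So all elements of order p generate one cyclic subgroup ⟨ x ⟩, and it
-- is the unique subgroup of order p.

open import Defs
open import Data.Nat using (ℕ)
open import Data.Nat.Divisibility using (_∣_)
open import Data.Nat.Primality using (Prime)

open import Data.Nat
  using (zero; suc; _+_; _*_; _∸_; _≤_; _<_; z≤n; s≤s; s≤s⁻¹; _%_; _/_; NonZero; >-nonZero; nonTrivial⇒n>1)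
  renaming (_^_ to _^ℕ_)
open import Data.Nat.Properties hiding (_≟_)
open import Data.Nat.GeneralisedArithmetic using (fold; fold-+)
open import Data.Nat.Divisibility using (divides; ∣-refl; ∣-trans; ∣⇒≤; m∣m*n; n∣m*n; ∣m+n∣m⇒∣n)
open import Data.Nat.DivMod using (m≡m%n+[m/n]*n; m%n<n)
open import Data.Nat.GCD using (GCD; gcd; gcd-GCD; module Bézout; c*gcd[m,n]≡gcd[cm,cn]; gcd[m,n]∣m; gcd[m,n]∣n)
open import Data.Nat.Coprimality using (prime⇒coprime; coprime⇒GCD≡1; coprime-Bézout)
open import Data.Nat.Primality using (prime⇒nonTrivial; ¬prime[0]; ¬prime[1])
open import Data.Fin using (Fin; zero; suc; toℕ; fromℕ<)
open import Data.Fin.Properties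
  using (_≟_; any?; toℕ-injective; toℕ<n; toℕ-fromℕ<) renaming (suc-injective to Fin-suc-injective)
open import Data.Fin.Subset using (Subset; ∣_∣; _⊆_; inside; outside) renaming (_∈_ to _∈ₛ_)
open import Data.Fin.Subset.Properties using (_∈?_; _⊂?_; p⊂q⇒∣p∣<∣q∣; ⊆-antisym)
open import Data.Vec using ([]; _∷_; tabulate)
open import Data.Vec.Properties using (lookup∘tabulate; lookup⇒[]=; []=⇒lookup)
open import Data.Bool using (Bool; true; false)
open import Data.List
  using (List; []; _∷_; [_]; map; _++_; filter; length; allFin; replicate; cartesianProductWith)
  renaming (tabulate to tabulateᴸ)
open import Data.List.Properties
  using (length-map; length-++; length-tabulate; length-replicate; ++-assoc; ++-identityʳ; ∷-injective; ∷-injectiveʳ; ≡-dec)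
open import Data.List.Membership.Propositional using (_∈_; find)
open import Data.List.Membership.Propositional.Properties
  using (∈-map⁺; ∈-map⁻; ∈-filter⁺; ∈-filter⁻; ∈-++⁺ˡ; ∈-++⁺ʳ; ∈-++⁻; ∈-allFin; ∈-length;
         ∈-cartesianProductWith⁺; ∈-cartesianProductWith⁻)
open import Data.List.Membership.Propositional.Properties.WithK using (unique∧set⇒bag)
open import Data.List.Relation.Binary.BagAndSetEquality using (∼bag⇒↭)
open import Data.List.Relation.Binary.Permutation.Propositional.Properties using (↭-length)
open import Data.List.Relation.Unary.Unique.Propositional using (Unique)
import Data.List.Relation.Unary.Unique.Propositional.Properties as Unique
open import Data.List.Relation.Unary.All as All using (All; all?; []; _∷_)
open import Data.List.Relation.Unary.AllPairs using ([]; _∷_)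
open import Data.List.Relation.Unary.Any using (here; there)
open import Data.List.Relation.Unary.All.Properties using (¬All⇒Any¬; ++⁺; replicate⁺)
open import Data.Product using (∃; _×_; _,_; proj₁; proj₂)
open import Data.Sum using (_⊎_; inj₁; inj₂)
open import Data.Empty using (⊥; ⊥-elim)
open import Function.Bundles using (mk⇔)
open import Relation.Nullary using (¬_; Dec; yes; no; ¬?; does)
open import Relation.Nullary.Decidable using (dec-true)
open import Relation.Binary.Definitions using (DecidableEquality; tri<; tri≈; tri>)
open import Relation.Binary.PropositionalEquality hiding ([_])
open import Algebra.Bundles using (Group)
open import Algebra.Structures using (IsGroup)
import Algebra.Properties.Group as GroupProperties

module Iteration {A : Set} (σ : A → A) where

  fold-σ : ∀ a k → fold (σ a) σ k ≡ σ (fold a σ k)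
  fold-σ a k = trans (sym (fold-+ a σ k)) (cong (fold a σ) (+-comm k 1))

  fold-periodic : ∀ {a m} → fold a σ m ≡ a → ∀ k → fold a σ (k * m) ≡ a
  fold-periodic         e zero    = refl
  fold-periodic {a} {m} e (suc k) = begin
    fold a σ (m + k * m)         ≡⟨ fold-+ a σ m ⟩
    fold (fold a σ (k * m)) σ m  ≡⟨ cong (λ z → fold z σ m) (fold-periodic e k) ⟩
    fold a σ m                   ≡⟨ e ⟩
    a                            ∎
    where open ≡-Reasoning

  fold-period-∸ : ∀ {a} d t → fold a σ t ≡ a → fold a σ (d + t) ≡ a → fold a σ d ≡ a
  fold-period-∸ {a} d t et edt = begin
    fold a σ d               ≡⟨ cong (λ z → fold z σ d) et ⟨
    fold (fold a σ t) σ d    ≡⟨ fold-+ a σ d ⟨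
    fold a σ (d + t)         ≡⟨ edt ⟩
    a                        ∎
    where open ≡-Reasoning

  fold-period-gcd : ∀ {a m k d} → GCD m k d → fold a σ m ≡ a → fold a σ k ≡ a → fold a σ d ≡ a
  fold-period-gcd {a} {m} {k} {d} g em ek with Bézout.identity g
  ... | Bézout.+- x y eq = fold-period-∸ d (y * k) (fold-periodic ek y)
                             (trans (cong (fold a σ) eq) (fold-periodic em x))
  ... | Bézout.-+ x y eq = fold-period-∸ d (x * m) (fold-periodic em x)
                             (trans (cong (fold a σ) eq) (fold-periodic ek y))

  fold-mod : ∀ {a} p .{{_ : NonZero p}} → fold a σ p ≡ a → ∀ k → fold a σ k ≡ fold a σ (k % p)
  fold-mod {a} p e k = begin
    fold a σ k                               ≡⟨ cong (fold a σ) (m≡m%n+[m/n]*n k p) ⟩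
    fold a σ (k % p + (k / p) * p)           ≡⟨ fold-+ a σ (k % p) ⟩
    fold (fold a σ ((k / p) * p)) σ (k % p)  ≡⟨ cong (λ z → fold z σ (k % p)) (fold-periodic e (k / p)) ⟩
    fold a σ (k % p)                         ∎
    where open ≡-Reasoning

  fixed-by-prime-period : ∀ {a p d} → Prime p → 0 < d → d < p →
                          fold a σ d ≡ a → fold a σ p ≡ a → σ a ≡ a
  fixed-by-prime-period p-prime 0<d d<p ed ep =
    fold-period-gcd (coprime⇒GCD≡1 (prime⇒coprime p-prime {{>-nonZero 0<d}} d<p)) ep ed

  iterates-distinct : ∀ {a p i j} → Prime p → ¬ σ a ≡ a → fold a σ p ≡ a →
                      i < j → j < p → ¬ fold a σ i ≡ fold a σ j
  iterates-distinct {a} {p} {i} {j} p-prime moves ep i<j j<p eij =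
    moves (fixed-by-prime-period p-prime 0<d d<p ed ep)
    where
    open ≡-Reasoning
    d = p ∸ j + i
    0<d : 0 < d
    0<d = <-≤-trans (m<n⇒0<n∸m j<p) (m≤m+n (p ∸ j) i)
    d<p : d < p
    d<p = subst (d <_) (m∸n+n≡m (<⇒≤ j<p)) (+-monoʳ-< (p ∸ j) i<j)
    ed : fold a σ d ≡ a
    ed = begin
      fold a σ (p ∸ j + i)         ≡⟨ fold-+ a σ (p ∸ j) ⟩
      fold (fold a σ i) σ (p ∸ j)  ≡⟨ cong (λ z → fold z σ (p ∸ j)) eij ⟩
      fold (fold a σ j) σ (p ∸ j)  ≡⟨ fold-+ a σ (p ∸ j) ⟨
      fold a σ (p ∸ j + j)         ≡⟨ cong (fold a σ) (m∸n+n≡m (<⇒≤ j<p)) ⟩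
      fold a σ p                   ≡⟨ ep ⟩
      a                            ∎

  iterates-injective : ∀ {a p} → Prime p → ¬ σ a ≡ a → fold a σ p ≡ a →
                       ∀ {i j : Fin p} → fold a σ (toℕ i) ≡ fold a σ (toℕ j) → i ≡ j
  iterates-injective {p = p} p-prime moves ep {i} {j} eij with <-cmp (toℕ i) (toℕ j)
  ... | tri< i<j _ _ = ⊥-elim (iterates-distinct p-prime moves ep i<j (toℕ<n j) eij)
  ... | tri≈ _ i≡j _ = toℕ-injective i≡j
  ... | tri> _ _ j<i = ⊥-elim (iterates-distinct p-prime moves ep j<i (toℕ<n i) (sym eij))

  fixed-along-orbit : ∀ {a p k} → fold a σ p ≡ a → k ≤ p → σ (fold a σ k) ≡ fold a σ k → σ a ≡ a
  fixed-along-orbit {a} {p} {k} ep k≤p fixed = begin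
    σ a                               ≡⟨ cong σ (trans (cong (fold a σ) (m∸n+n≡m k≤p)) ep) ⟨
    σ (fold a σ (p ∸ k + k))          ≡⟨ cong σ (fold-+ a σ (p ∸ k)) ⟩
    σ (fold (fold a σ k) σ (p ∸ k))   ≡⟨ fold-σ (fold a σ k) (p ∸ k) ⟨
    fold (σ (fold a σ k)) σ (p ∸ k)   ≡⟨ cong (λ z → fold z σ (p ∸ k)) fixed ⟩
    fold (fold a σ k) σ (p ∸ k)       ≡⟨ fold-+ a σ (p ∸ k) ⟨
    fold a σ (p ∸ k + k)              ≡⟨ cong (fold a σ) (m∸n+n≡m k≤p) ⟩
    fold a σ p                        ≡⟨ ep ⟩
    a                                 ∎
    where open ≡-Reasoning

same-length : ∀ {A : Set} {xs ys : List A} → Unique xs → Unique ys →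
              (∀ {x} → x ∈ xs → x ∈ ys) → (∀ {x} → x ∈ ys → x ∈ xs) → length xs ≡ length ys
same-length uxs uys to from = ↭-length (∼bag⇒↭ (unique∧set⇒bag uxs uys (mk⇔ to from)))

length-allFin : ∀ n → length (allFin n) ≡ n
length-allFin n = length-tabulate (λ i → i)

length-cartesianProductWith : ∀ {A B C : Set} (f : A → B → C) xs ys →
  length (cartesianProductWith f xs ys) ≡ length xs * length ys
length-cartesianProductWith f []       ys = refl
length-cartesianProductWith f (x ∷ xs) ys =
  trans (length-++ (map (f x) ys)) (cong₂ _+_ (length-map (f x) ys) (length-cartesianProductWith f xs ys))

other-than : ∀ {A : Set} (_≟ᴬ_ : DecidableEquality A) (e : A) {xs : List A} → Unique xs → 2 ≤ length xs →
             ∃ λ y → y ∈ xs × ¬ y ≡ e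
other-than _≟ᴬ_ e {y₁ ∷ y₂ ∷ _} ((y₁≢y₂ ∷ _) ∷ _) _ with y₁ ≟ᴬ e
... | no  y₁≢e = y₁ , here refl , y₁≢e
... | yes y₁≡e = y₂ , there (here refl) , λ y₂≡e → y₁≢y₂ (trans y₁≡e (sym y₂≡e))
other-than _ _ {_ ∷ []} _ (s≤s ())

-- Orbit counting for a map σ of prime period p = q + 1: on a finite σ-stable
-- set X, |X| ≡ |Fix σ ∩ X| (mod p).  Induction on |X|: the orbit of a point
-- that is not fixed has exactly p elements and no fixed points, and its
-- complement is again σ-stable.
module OrbitCounting {A : Set} (_≟ᴬ_ : DecidableEquality A) (σ : A → A) (q : ℕ) (p-prime : Prime (suc q)) where
  open Iteration σ

  p : ℕ
  p = suc q

  fixed? : ∀ a → Dec (σ a ≡ a)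
  fixed? a = σ a ≟ᴬ a

  Fix : List A → List A
  Fix = filter fixed?

  record PeriodicSet (xs : List A) : Set where
    field
      unique   : Unique xs
      closed   : ∀ {a} → a ∈ xs → σ a ∈ xs
      periodic : ∀ {a} → a ∈ xs → fold a σ p ≡ a

  FixCongruent : List A → Set
  FixCongruent xs = ∃ λ m → length xs ≡ length (Fix xs) + m * p

  module RemoveOrbit {xs : List A} (X : PeriodicSet xs) {a : A} (a∈xs : a ∈ xs) (a-moves : ¬ σ a ≡ a) where
    open PeriodicSet X

    orbitPt : Fin p → A
    orbitPt i = fold a σ (toℕ i)

    orbit : List A
    orbit = map orbitPt (allFin p)

    InOrbit : A → Set
    InOrbit b = ∃ λ i → b ≡ orbitPt i

    inOrbit? : ∀ b → Dec (InOrbit b)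
    inOrbit? b = any? (λ i → b ≟ᴬ orbitPt i)

    outside? : ∀ b → Dec (¬ InOrbit b)
    outside? b = ¬? (inOrbit? b)

    rest : List A
    rest = filter outside? xs

    a-period : fold a σ p ≡ a
    a-period = periodic a∈xs

    iterate-inOrbit : ∀ k → InOrbit (fold a σ k)
    iterate-inOrbit k = fromℕ< (m%n<n k p) ,
      trans (fold-mod p a-period k) (cong (fold a σ) (sym (toℕ-fromℕ< (m%n<n k p))))

    inOrbit⇒∈xs : ∀ {b} → InOrbit b → b ∈ xs
    inOrbit⇒∈xs (i , refl) = iterates-∈ (toℕ i) a∈xs
      where
      iterates-∈ : ∀ k {b} → b ∈ xs → fold b σ k ∈ xs
      iterates-∈ zero    b∈ = b∈
      iterates-∈ (suc k) b∈ = closed (iterates-∈ k b∈)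

    ∈orbit⇒inOrbit : ∀ {b} → b ∈ orbit → InOrbit b
    ∈orbit⇒inOrbit b∈ with ∈-map⁻ orbitPt {xs = allFin p} b∈
    ... | i , _ , e = i , e

    inOrbit⇒∈orbit : ∀ {b} → InOrbit b → b ∈ orbit
    inOrbit⇒∈orbit (i , refl) = ∈-map⁺ orbitPt (∈-allFin i)

    -- the orbit is also closed under σ⁻¹ = σ ^ q on X
    σ-reflects-orbit : ∀ {b} → b ∈ xs → InOrbit (σ b) → InOrbit b
    σ-reflects-orbit {b} b∈ (i , e) = subst InOrbit (sym b≡) (iterate-inOrbit (q + toℕ i))
      where
      open ≡-Reasoning
      b≡ : b ≡ fold a σ (q + toℕ i)
      b≡ = begin
        b                          ≡⟨ periodic b∈ ⟨
        σ (fold b σ q)             ≡⟨ fold-σ b q ⟨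
        fold (σ b) σ q             ≡⟨ cong (λ z → fold z σ q) e ⟩
        fold (orbitPt i) σ q       ≡⟨ fold-+ a σ q ⟨
        fold a σ (q + toℕ i)       ∎

    orbit-moves : ∀ {b} → InOrbit b → ¬ σ b ≡ b
    orbit-moves (i , refl) fixed = a-moves (fixed-along-orbit a-period (<⇒≤ (toℕ<n i)) fixed)

    ∈rest⁻ : ∀ {b} → b ∈ rest → b ∈ xs × ¬ InOrbit b
    ∈rest⁻ = ∈-filter⁻ outside? {xs = xs}

    Rest : PeriodicSet rest
    Rest = record
      { unique   = Unique.filter⁺ outside? unique
      ; closed   = λ b∈ → let (b∈xs , b∉) = ∈rest⁻ b∈ in
                          ∈-filter⁺ outside? (closed b∈xs) (λ σb∈ → b∉ (σ-reflects-orbit b∈xs σb∈))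
      ; periodic = λ b∈ → periodic (proj₁ (∈rest⁻ b∈))
      }

    length-orbit : length orbit ≡ p
    length-orbit = trans (length-map orbitPt (allFin p)) (length-allFin p)

    length-split : length xs ≡ p + length rest
    length-split = trans (same-length unique (Unique.++⁺ orbit-unique (PeriodicSet.unique Rest) disjoint) split unsplit)
                         (trans (length-++ orbit) (cong (_+ length rest) length-orbit))
      where
      orbit-unique : Unique orbit
      orbit-unique = Unique.map⁺ (iterates-injective p-prime a-moves a-period) (Unique.allFin⁺ p)
      disjoint : ∀ {b} → ¬ (b ∈ orbit × b ∈ rest)
      disjoint (b∈orbit , b∈rest) = proj₂ (∈rest⁻ b∈rest) (∈orbit⇒inOrbit b∈orbit)
      split : ∀ {b} → b ∈ xs → b ∈ orbit ++ rest
      split {b} b∈ with inOrbit? b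
      ... | yes inO = ∈-++⁺ˡ (inOrbit⇒∈orbit inO)
      ... | no  b∉  = ∈-++⁺ʳ orbit (∈-filter⁺ outside? b∈ b∉)
      unsplit : ∀ {b} → b ∈ orbit ++ rest → b ∈ xs
      unsplit b∈ with ∈-++⁻ orbit b∈
      ... | inj₁ b∈orbit = inOrbit⇒∈xs (∈orbit⇒inOrbit b∈orbit)
      ... | inj₂ b∈rest  = proj₁ (∈rest⁻ b∈rest)

    -- all fixed points of X lie in the rest
    length-Fix : length (Fix xs) ≡ length (Fix rest)
    length-Fix = same-length (Unique.filter⁺ fixed? unique) (Unique.filter⁺ fixed? (PeriodicSet.unique Rest)) into back
      where
      into : ∀ {b} → b ∈ Fix xs → b ∈ Fix rest
      into b∈ with ∈-filter⁻ fixed? {xs = xs} b∈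
      ... | b∈xs , fixed = ∈-filter⁺ fixed? (∈-filter⁺ outside? b∈xs (λ inO → orbit-moves inO fixed)) fixed
      back : ∀ {b} → b ∈ Fix rest → b ∈ Fix xs
      back b∈ with ∈-filter⁻ fixed? {xs = rest} b∈
      ... | b∈rest , fixed = ∈-filter⁺ fixed? (proj₁ (∈rest⁻ b∈rest)) fixed

    rest-smaller : suc (length rest) ≤ length xs
    rest-smaller = ≤-trans (+-monoˡ-≤ (length rest) (s≤s z≤n)) (≤-reflexive (sym length-split))

    congruence-from-rest : FixCongruent rest → FixCongruent xs
    congruence-from-rest (m , e) = suc m , (begin
      length xs                               ≡⟨ length-split ⟩
      p + length rest                         ≡⟨ cong (p +_) e ⟩
      p + (length (Fix rest) + m * p)         ≡⟨ +-assoc p _ _ ⟨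
      (p + length (Fix rest)) + m * p         ≡⟨ cong (_+ m * p) (+-comm p _) ⟩
      (length (Fix rest) + p) + m * p         ≡⟨ +-assoc (length (Fix rest)) p _ ⟩
      length (Fix rest) + suc m * p           ≡⟨ cong (_+ suc m * p) length-Fix ⟨
      length (Fix xs) + suc m * p             ∎)
      where open ≡-Reasoning

  orbit-counting : ∀ {xs} → PeriodicSet xs → FixCongruent xs
  orbit-counting {xs} X = bounded (length xs) X ≤-refl
    where
    bounded : ∀ bound {xs} → PeriodicSet xs → length xs ≤ bound → FixCongruent xs
    bounded zero        {[]}    X _      = 0 , refl
    bounded zero        {_ ∷ _} X ()
    bounded (suc bound) {xs}    X |xs|≤ with all? fixed? xs
    ... | yes all-fixed = 0 , trans (same-length (PeriodicSet.unique X) (Unique.filter⁺ fixed? (PeriodicSet.unique X))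
                                                 (λ b∈ → ∈-filter⁺ fixed? b∈ (All.lookup all-fixed b∈))
                                                 (λ b∈ → proj₁ (∈-filter⁻ fixed? {xs = xs} b∈)))
                                    (sym (+-identityʳ _))
    ... | no some-moves with find (¬All⇒Any¬ fixed? xs some-moves)
    ...   | a , a∈xs , a-moves =
            congruence-from-rest (bounded bound Rest (s≤s⁻¹ (≤-trans rest-smaller |xs|≤)))
      where open RemoveOrbit X a∈xs a-moves

module Rotation {A : Set} where

  rotate : List A → List A
  rotate []       = []
  rotate (x ∷ xs) = xs ++ [ x ]

  rotate-++ : ∀ xs ys → fold (xs ++ ys) rotate (length xs) ≡ ys ++ xs
  rotate-++ []       ys = sym (++-identityʳ ys)
  rotate-++ (x ∷ xs) ys = begin
    rotate (fold (x ∷ xs ++ ys) rotate (length xs))  ≡⟨ Iteration.fold-σ rotate (x ∷ xs ++ ys) (length xs) ⟨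
    fold ((xs ++ ys) ++ [ x ]) rotate (length xs)     ≡⟨ cong (λ l → fold l rotate (length xs)) (++-assoc xs ys [ x ]) ⟩
    fold (xs ++ ys ++ [ x ]) rotate (length xs)       ≡⟨ rotate-++ xs (ys ++ [ x ]) ⟩
    (ys ++ [ x ]) ++ xs                               ≡⟨ ++-assoc ys [ x ] xs ⟩
    ys ++ x ∷ xs                                      ∎
    where open ≡-Reasoning

  rotate-period : ∀ xs → fold xs rotate (length xs) ≡ xs
  rotate-period xs = trans (cong (λ l → fold l rotate (length xs)) (sym (++-identityʳ xs))) (rotate-++ xs [])

  rotate-replicate : ∀ k (x : A) → rotate (replicate (suc k) x) ≡ replicate (suc k) x
  rotate-replicate zero    x = refl
  rotate-replicate (suc k) x = cong (x ∷_) (rotate-replicate k x)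

  rotation-fixed⇒constant : ∀ {h} xs → rotate (h ∷ xs) ≡ h ∷ xs → xs ≡ replicate (length xs) h
  rotation-fixed⇒constant []       _ = refl
  rotation-fixed⇒constant (x ∷ xs) e with ∷-injective e
  ... | refl , e′ = cong (x ∷_) (rotation-fixed⇒constant xs e′)

module Powers {n : ℕ} (G : FinGroup n) where
  open FinGroup G public
  open IsGroup isGroup public using (assoc; identityˡ; identityʳ; inverseˡ; inverseʳ)

  group : Group _ _
  group = record { isGroup = isGroup }

  open GroupProperties group public using (inverseˡ-unique; inverseʳ-unique)

  infixr 25 _^_
  _^_ : Fin n → ℕ → Fin n
  x ^ k = pow G x k

  _∈⟨_⟩ : Fin n → Fin n → Set
  x ∈⟨ g ⟩ = ∃ λ k → x ≡ g ^ k

  ^-as-fold : ∀ g k → g ^ k ≡ fold ε (g ∙_) k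
  ^-as-fold g zero    = refl
  ^-as-fold g (suc k) = cong (g ∙_) (^-as-fold g k)

  ^-+ : ∀ g a b → g ^ (a + b) ≡ g ^ a ∙ g ^ b
  ^-+ g zero    b = sym (identityˡ _)
  ^-+ g (suc a) b = trans (cong (g ∙_) (^-+ g a b)) (sym (assoc g _ _))

  ^-* : ∀ g m k → g ^ (k * m) ≡ (g ^ m) ^ k
  ^-* g m zero    = refl
  ^-* g m (suc k) = trans (^-+ g m (k * m)) (cong (g ^ m ∙_) (^-* g m k))

  ε^ : ∀ k → ε ^ k ≡ ε
  ε^ zero    = refl
  ε^ (suc k) = trans (identityˡ _) (ε^ k)

  ^-multiple : ∀ {g m} → g ^ m ≡ ε → ∀ k → g ^ (k * m) ≡ ε
  ^-multiple {g} {m} e k = trans (^-* g m k) (trans (cong (_^ k) e) (ε^ k))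

  ^-annihilates-powers : ∀ g m → g ^ m ≡ ε → ∀ k → (g ^ k) ^ m ≡ ε
  ^-annihilates-powers g m e k = trans (sym (^-* g k m)) (trans (cong (g ^_) (*-comm m k)) (^-multiple e k))

  ∈⟨⟩-trans : ∀ {x y z} → x ∈⟨ y ⟩ → y ∈⟨ z ⟩ → x ∈⟨ z ⟩
  ∈⟨⟩-trans {z = z} (k , refl) (m , refl) = k * m , sym (^-* z m k)

  period-gcd : ∀ {g a b d} → GCD a b d → g ^ a ≡ ε → g ^ b ≡ ε → g ^ d ≡ ε
  period-gcd {g} {a} {b} {d} gcd-d ea eb = trans (^-as-fold g d)
    (Iteration.fold-period-gcd (g ∙_) gcd-d (trans (sym (^-as-fold g a)) ea) (trans (sym (^-as-fold g b)) eb))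

  ^-mod : ∀ {g} p .{{_ : NonZero p}} → g ^ p ≡ ε → ∀ k → g ^ k ≡ g ^ (k % p)
  ^-mod {g} p e k = trans (^-as-fold g k) (trans
    (Iteration.fold-mod (g ∙_) p (trans (sym (^-as-fold g p)) e) k) (sym (^-as-fold g (k % p))))

module PrimeOrder {n : ℕ} (G : FinGroup n) (q : ℕ) (p-prime : Prime (suc q)) where
  open Powers G

  p : ℕ
  p = suc q

  OrderP : Fin n → Set
  OrderP g = g ^ p ≡ ε × ¬ g ≡ ε

  solution? : ∀ x → Dec (x ^ p ≡ ε)
  solution? x = x ^ p ≟ ε

  Solutions : List (Fin n) → List (Fin n)
  Solutions = filter solution?

  powers-injective : ∀ {g} → OrderP g → ∀ {i j : Fin p} → g ^ toℕ i ≡ g ^ toℕ j → i ≡ j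
  powers-injective {g} (g^p , g≢ε) {i} {j} eij =
    Iteration.iterates-injective (g ∙_) p-prime moves-ε (trans (sym (^-as-fold g p)) g^p)
      (trans (sym (^-as-fold g (toℕ i))) (trans eij (^-as-fold g (toℕ j))))
    where
    moves-ε : ¬ g ∙ ε ≡ ε
    moves-ε e = g≢ε (trans (sym (identityʳ g)) e)

  powers : Fin n → List (Fin n)
  powers g = map (λ i → g ^ toℕ i) (allFin p)

  powers-unique : ∀ {g} → OrderP g → Unique (powers g)
  powers-unique og = Unique.map⁺ (powers-injective og) (Unique.allFin⁺ p)

  length-powers : ∀ g → length (powers g) ≡ p
  length-powers g = trans (length-map (λ i → g ^ toℕ i) (allFin p)) (length-allFin p)

  InPowers : Fin n → Fin n → Set
  InPowers g y = ∃ λ (i : Fin p) → y ≡ g ^ toℕ i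

  inPowers? : ∀ g y → Dec (InPowers g y)
  inPowers? g y = any? (λ i → y ≟ g ^ toℕ i)

  ∈⟨⟩⇒InPowers : ∀ {g y} → g ^ p ≡ ε → y ∈⟨ g ⟩ → InPowers g y
  ∈⟨⟩⇒InPowers {g} g^p (k , refl) =
    fromℕ< (m%n<n k p) , trans (^-mod p g^p k) (cong (g ^_) (sym (toℕ-fromℕ< (m%n<n k p))))

  ∉⟨⟩-from-InPowers : ∀ {g y} → g ^ p ≡ ε → ¬ InPowers g y → ¬ y ∈⟨ g ⟩
  ∉⟨⟩-from-InPowers g^p y∉ y∈ = y∉ (∈⟨⟩⇒InPowers g^p y∈)

  InPowers⇔∈powers : ∀ {g y} → (InPowers g y → y ∈ powers g) × (y ∈ powers g → InPowers g y)
  InPowers⇔∈powers {g} = (λ { (i , refl) → ∈-map⁺ (λ i → g ^ toℕ i) (∈-allFin i) })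
                        , (λ y∈ → let (i , _ , y≡) = ∈-map⁻ (λ i → g ^ toℕ i) {xs = allFin p} y∈ in i , y≡)

  inverse-as-power : ∀ {h} → h ^ p ≡ ε → h ⁻¹ ≡ h ^ q
  inverse-as-power {h} h^p = sym (inverseʳ-unique h (h ^ q) h^p)

  -- if g ^ p = ε, every power x ≠ ε of g generates g: x = g ^ r with r
  -- coprime to p, and Bézout inverts r modulo p
  generates-back : ∀ {g x} → g ^ p ≡ ε → x ∈⟨ g ⟩ → ¬ x ≡ ε → g ∈⟨ x ⟩
  generates-back {g} g^p (k , refl) x≢ε =
    subst (g ∈⟨_⟩) (sym (^-mod p g^p k)) (coprime-exponent (k % p) (m%n<n k p) reduced≢ε)
    where
    open ≡-Reasoning
    reduced≢ε : ¬ g ^ (k % p) ≡ ε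
    reduced≢ε e = x≢ε (trans (^-mod p g^p k) e)
    coprime-exponent : ∀ r → r < p → ¬ g ^ r ≡ ε → g ∈⟨ g ^ r ⟩
    coprime-exponent zero      _   g^0≢ε = ⊥-elim (g^0≢ε refl)
    coprime-exponent r@(suc _) r<p _ with coprime-Bézout (prime⇒coprime p-prime r<p)
    ... | Bézout.-+ s t eq = t , (begin
      g                      ≡⟨ identityʳ g ⟨
      g ∙ ε                  ≡⟨ cong (g ∙_) (^-multiple g^p s) ⟨
      g ^ (1 + s * p)        ≡⟨ cong (g ^_) eq ⟩
      g ^ (t * r)            ≡⟨ ^-* g r t ⟩
      (g ^ r) ^ t            ∎)
    ... | Bézout.+- s t eq = q * t , (begin
      g                      ≡⟨ inverseˡ-unique g h g∙h≡ε ⟩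
      h ⁻¹                   ≡⟨ inverse-as-power (^-annihilates-powers (g ^ r) p (^-annihilates-powers g p g^p r) t) ⟩
      h ^ q                  ≡⟨ ^-* (g ^ r) t q ⟨
      (g ^ r) ^ (q * t)      ∎)
      where
      h = (g ^ r) ^ t
      g∙h≡ε : g ∙ h ≡ ε
      g∙h≡ε = begin
        g ∙ (g ^ r) ^ t      ≡⟨ cong (g ∙_) (^-* g r t) ⟨
        g ^ (1 + t * r)      ≡⟨ cong (g ^_) eq ⟩
        g ^ (s * p)          ≡⟨ ^-multiple g^p s ⟩
        ε                    ∎

  -- a cyclic group ⟨ z ⟩ has at most one subgroup of order p: with
  -- x = z ^ i, y = z ^ j and w = z ^ gcd i j we get w ^ p = ε, so w ∈⟨ x ⟩
  unique-order-p-in-cyclic : ∀ {z x y} → x ∈⟨ z ⟩ → y ∈⟨ z ⟩ → OrderP x → y ^ p ≡ ε → y ∈⟨ x ⟩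
  unique-order-p-in-cyclic {z} (i , refl) (j , refl) (x^p , x≢ε) y^p
    with gcd[m,n]∣m i j | gcd[m,n]∣n i j
  ... | divides i' i≡ | divides j' j≡ = ∈⟨⟩-trans y∈⟨w⟩ (generates-back w^p x∈⟨w⟩ x≢ε)
    where
    g = gcd i j
    w = z ^ g
    w^p : w ^ p ≡ ε
    w^p = trans (sym (^-* z g p))
      (subst (λ d → z ^ d ≡ ε) (sym (c*gcd[m,n]≡gcd[cm,cn] p i j))
        (period-gcd (gcd-GCD (p * i) (p * j)) (trans (^-* z i p) x^p) (trans (^-* z j p) y^p)))
    x∈⟨w⟩ : z ^ i ∈⟨ w ⟩
    x∈⟨w⟩ = i' , trans (cong (z ^_) i≡) (^-* z g i')
    y∈⟨w⟩ : z ^ j ∈⟨ w ⟩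
    y∈⟨w⟩ = j' , trans (cong (z ^_) j≡) (^-* z g j')

no-three-distinct-in-Fin2 : (x y z : Fin 2) → ¬ x ≡ y → ¬ x ≡ z → ¬ y ≡ z → ⊥
no-three-distinct-in-Fin2 zero       zero       _          x≢y _   _   = x≢y refl
no-three-distinct-in-Fin2 zero       (suc zero) zero       _   x≢z _   = x≢z refl
no-three-distinct-in-Fin2 zero       (suc zero) (suc zero) _   _   y≢z = y≢z refl
no-three-distinct-in-Fin2 (suc zero) zero       zero       _   _   y≢z = y≢z refl
no-three-distinct-in-Fin2 (suc zero) zero       (suc zero) _   x≢z _   = x≢z refl
no-three-distinct-in-Fin2 (suc zero) (suc zero) _          x≢y _   _   = x≢y refl

-- In a rainbow 2-colouring every rainbow path has at most two edges.
module RainbowTwoColouring {n : ℕ} (G : FinGroup n) (c : Fin n → Fin n → Fin 2)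
                           (rainbow : IsRainbowColouring G 2 c) where

  colours-around-unique-neighbour : ∀ {u v z} → ¬ u ≡ v → ¬ PowAdj G u v →
    (∀ w → PowAdj G u w → PowAdj G w v → w ≡ z) → ¬ c u z ≡ c z v
  colours-around-unique-neighbour {u} {v} u≢v not-adjacent only-z with proj₂ rainbow u v
  ... | _ , here _ , _ , _ = λ _ → u≢v refl
  ... | _ , step u~v (here _) , _ , _ = λ _ → not-adjacent u~v
  ... | _ , step {w = w} u~w (step w~v (here _)) , _ , ((cuw≢cwv ∷ _) ∷ _) =
          subst (λ z → ¬ c u z ≡ c z v) (only-z w u~w w~v) cuw≢cwv
  ... | _ , step _ (step _ (step _ (here _))) , _ , ((c₁≢c₂ ∷ c₁≢c₃ ∷ _) ∷ (c₂≢c₃ ∷ _) ∷ _) =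
          λ _ → no-three-distinct-in-Fin2 _ _ _ c₁≢c₂ c₁≢c₃ c₂≢c₃
  ... | _ , step _ (step _ (step _ (step _ _))) , _ , ((c₁≢c₂ ∷ c₁≢c₃ ∷ _) ∷ (c₂≢c₃ ∷ _) ∷ _) =
          λ _ → no-three-distinct-in-Fin2 _ _ _ c₁≢c₂ c₁≢c₃ c₂≢c₃

-- Elements of order p that are not powers of each other ("independent").
-- Their only common neighbour in Γ_G is ε, so a rainbow 2-colouring gives the
-- edges a – ε and b – ε different colours, and three pairwise independent
-- elements of order p cannot exist.
module IndependentElements {n : ℕ} (G : FinGroup n) (q : ℕ) (p-prime : Prime (suc q))
                           (c : Fin n → Fin n → Fin 2) (rainbow : IsRainbowColouring G 2 c) where
  open Powers G
  open PrimeOrder G q p-prime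
  open RainbowTwoColouring G c rainbow

  ∉⟨⟩-sym : ∀ {a b} → OrderP a → OrderP b → ¬ b ∈⟨ a ⟩ → ¬ a ∈⟨ b ⟩
  ∉⟨⟩-sym (_ , a≢ε) (b^p , _) b∉⟨a⟩ a∈⟨b⟩ = b∉⟨a⟩ (generates-back b^p a∈⟨b⟩ a≢ε)

  only-common-neighbour-is-ε : ∀ {a b} → OrderP a → OrderP b → ¬ b ∈⟨ a ⟩ →
                               ∀ w → PowAdj G a w → PowAdj G w b → w ≡ ε
  only-common-neighbour-is-ε {a} {b} oa@(a^p , _) (b^p , _) b∉⟨a⟩ w (_ , a~w) (_ , w~b) with w ≟ ε
  ... | yes w≡ε = w≡ε
  ... | no  w≢ε = ⊥-elim (cases a~w w~b)
    where
    a∉⟨b⟩ : ¬ a ∈⟨ b ⟩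
    a∉⟨b⟩ = ∉⟨⟩-sym oa (b^p , λ b≡ε → b∉⟨a⟩ (0 , b≡ε)) b∉⟨a⟩
    cases : w ∈⟨ a ⟩ ⊎ a ∈⟨ w ⟩ → b ∈⟨ w ⟩ ⊎ w ∈⟨ b ⟩ → ⊥
    cases (inj₁ w∈⟨a⟩) (inj₁ b∈⟨w⟩) = b∉⟨a⟩ (∈⟨⟩-trans b∈⟨w⟩ w∈⟨a⟩)
    cases (inj₁ w∈⟨a⟩) (inj₂ w∈⟨b⟩) = a∉⟨b⟩ (∈⟨⟩-trans (generates-back a^p w∈⟨a⟩ w≢ε) w∈⟨b⟩)
    cases (inj₂ a∈⟨w⟩) (inj₁ b∈⟨w⟩) = b∉⟨a⟩ (unique-order-p-in-cyclic a∈⟨w⟩ b∈⟨w⟩ oa b^p)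
    cases (inj₂ a∈⟨w⟩) (inj₂ w∈⟨b⟩) = a∉⟨b⟩ (∈⟨⟩-trans a∈⟨w⟩ w∈⟨b⟩)

  colours-at-ε-differ : ∀ {a b} → OrderP a → OrderP b → ¬ b ∈⟨ a ⟩ → ¬ c a ε ≡ c b ε
  colours-at-ε-differ {a} {b} oa ob b∉⟨a⟩ same =
    colours-around-unique-neighbour a≢b not-adjacent (only-common-neighbour-is-ε oa ob b∉⟨a⟩)
      (trans same (proj₁ rainbow b ε b~ε))
    where
    a≢b : ¬ a ≡ b
    a≢b refl = b∉⟨a⟩ (1 , sym (identityʳ a))
    not-adjacent : ¬ PowAdj G a b
    not-adjacent (_ , inj₁ b∈⟨a⟩) = b∉⟨a⟩ b∈⟨a⟩
    not-adjacent (_ , inj₂ a∈⟨b⟩) = ∉⟨⟩-sym oa ob b∉⟨a⟩ a∈⟨b⟩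
    b~ε : PowAdj G b ε
    b~ε = proj₂ ob , inj₁ (0 , refl)

  no-three-independent : ∀ {a b d} → OrderP a → OrderP b → OrderP d →
                         ¬ b ∈⟨ a ⟩ → ¬ d ∈⟨ a ⟩ → ¬ d ∈⟨ b ⟩ → ⊥
  no-three-independent oa ob od b∉⟨a⟩ d∉⟨a⟩ d∉⟨b⟩ = no-three-distinct-in-Fin2 _ _ _
    (colours-at-ε-differ oa ob b∉⟨a⟩) (colours-at-ε-differ oa od d∉⟨a⟩) (colours-at-ε-differ ob od d∉⟨b⟩)

prime-divides-power : ∀ {q m} → Prime (suc q) → suc q ∣ m → suc q ∣ m ^ℕ q
prime-divides-power {zero}  p-prime _   = ⊥-elim (¬prime[1] p-prime)
prime-divides-power {suc _} _       p∣m = ∣-trans p∣m (m∣m*n _)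

record IsFiniteSubgroup {n : ℕ} (G : FinGroup n) (Ls : List (Fin n)) : Set where
  open FinGroup G
  field
    unique    : Unique Ls
    ε∈        : ε ∈ Ls
    ∙-closed  : ∀ {x y} → x ∈ Ls → y ∈ Ls → (x ∙ y) ∈ Ls
    ⁻¹-closed : ∀ {x} → x ∈ Ls → (x ⁻¹) ∈ Ls

-- McKay's proof of Cauchy's theorem: in a finite subgroup L with p ∣ |L|,
-- p divides the number of solutions of x ^ p = ε.  The p-tuples over L with
-- product ε are the tuples ((x₁ ⋯ x_q)⁻¹, x₁, …, x_q), so there are |L| ^ q of
-- them; rotation maps them to each other with period p, and the fixed ones
-- are the constant tuples (x, …, x) with x ^ p = ε.
module McKay {n : ℕ} (G : FinGroup n) (q : ℕ) (p-prime : Prime (suc q)) where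
  open Powers G
  open PrimeOrder G q p-prime
  open Rotation {Fin n}
  open OrbitCounting (≡-dec _≟_) rotate q p-prime using (PeriodicSet; Fix; fixed?; orbit-counting)

  product : List (Fin n) → Fin n
  product []       = ε
  product (x ∷ xs) = x ∙ product xs

  product-++ : ∀ xs ys → product (xs ++ ys) ≡ product xs ∙ product ys
  product-++ []       ys = sym (identityˡ _)
  product-++ (x ∷ xs) ys = trans (cong (x ∙_) (product-++ xs ys)) (sym (assoc x _ _))

  product-replicate : ∀ k x → product (replicate k x) ≡ x ^ k
  product-replicate zero    x = refl
  product-replicate (suc k) x = cong (x ∙_) (product-replicate k x)

  module _ {Ls : List (Fin n)} (L : IsFiniteSubgroup G Ls) where
    open IsFiniteSubgroup L

    tuples : ℕ → List (List (Fin n))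
    tuples zero    = [ [] ]
    tuples (suc k) = cartesianProductWith _∷_ Ls (tuples k)

    length-tuples : ∀ k → length (tuples k) ≡ length Ls ^ℕ k
    length-tuples zero    = refl
    length-tuples (suc k) = trans (length-cartesianProductWith _∷_ Ls (tuples k)) (cong (length Ls *_) (length-tuples k))

    tuples-unique : ∀ k → Unique (tuples k)
    tuples-unique zero    = [] ∷ []
    tuples-unique (suc k) = Unique.cartesianProductWith⁺ _∷_ ∷-injective unique (tuples-unique k)

    ∈tuples⁻ : ∀ k {v} → v ∈ tuples k → length v ≡ k × All (_∈ Ls) v
    ∈tuples⁻ zero    (here refl) = refl , []
    ∈tuples⁻ (suc k) v∈ with ∈-cartesianProductWith⁻ _∷_ Ls (tuples k) v∈
    ... | _ , _ , x∈ , w∈ , refl with ∈tuples⁻ k w∈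
    ...   | |w| , all∈ = cong suc |w| , (x∈ ∷ all∈)

    ∈tuples⁺ : ∀ k {v} → length v ≡ k → All (_∈ Ls) v → v ∈ tuples k
    ∈tuples⁺ zero    {[]}    _   _            = here refl
    ∈tuples⁺ (suc k) {x ∷ v} |v| (x∈ ∷ all∈) = ∈-cartesianProductWith⁺ _∷_ x∈ (∈tuples⁺ k (suc-injective |v|) all∈)

    product-∈ : ∀ {v} → All (_∈ Ls) v → product v ∈ Ls
    product-∈ []          = ε∈
    product-∈ (x∈ ∷ all∈) = ∙-closed x∈ (product-∈ all∈)

    Balanced : List (Fin n) → Set
    Balanced w = length w ≡ p × All (_∈ Ls) w × product w ≡ ε

    complete : List (Fin n) → List (Fin n)
    complete v = product v ⁻¹ ∷ v

    balanced : List (List (Fin n))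
    balanced = map complete (tuples q)

    ∈balanced⁻ : ∀ {w} → w ∈ balanced → Balanced w
    ∈balanced⁻ w∈ with ∈-map⁻ complete w∈
    ... | v , v∈ , refl with ∈tuples⁻ q v∈
    ...   | |v| , all∈ = cong suc |v| , (⁻¹-closed (product-∈ all∈) ∷ all∈) , inverseˡ (product v)

    ∈balanced⁺ : ∀ {w} → Balanced w → w ∈ balanced
    ∈balanced⁺ {h ∷ v} (|w| , (_ ∷ all∈) , product≡ε) =
      subst (_∈ balanced) (cong (_∷ v) (sym (inverseˡ-unique h (product v) product≡ε)))
        (∈-map⁺ complete (∈tuples⁺ q (suc-injective |w|) all∈))

    rotate-balanced : ∀ {w} → Balanced w → Balanced (rotate w)
    rotate-balanced {h ∷ v} (|w| , (h∈ ∷ all∈) , product≡ε) =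
      trans (length-++ v) (trans (+-comm (length v) 1) |w|) ,
      ++⁺ all∈ (h∈ ∷ []) ,
      (begin
        product (v ++ [ h ])      ≡⟨ product-++ v [ h ] ⟩
        product v ∙ (h ∙ ε)       ≡⟨ cong (product v ∙_) (identityʳ h) ⟩
        product v ∙ h             ≡⟨ cong (product v ∙_) (inverseˡ-unique h (product v) product≡ε) ⟩
        product v ∙ (product v ⁻¹) ≡⟨ inverseʳ (product v) ⟩
        ε                         ∎)
      where open ≡-Reasoning

    Balanced-periodic : PeriodicSet balanced
    Balanced-periodic = record
      { unique   = Unique.map⁺ ∷-injectiveʳ (tuples-unique q)
      ; closed   = λ w∈ → ∈balanced⁺ (rotate-balanced (∈balanced⁻ w∈))
      ; periodic = λ {w} w∈ → subst (λ k → fold w rotate k ≡ w) (proj₁ (∈balanced⁻ w∈)) (rotate-period w)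
      }

    fixed-balanced : ∀ {w} → Balanced w → rotate w ≡ w → ∃ λ h → w ≡ replicate p h × h ∈ Ls × h ^ p ≡ ε
    fixed-balanced {[]}    (() , _)
    fixed-balanced {h ∷ v} (|w| , (h∈ ∷ _) , product≡ε) fixed = h , w≡ , h∈ , h^p
      where
      w≡ : h ∷ v ≡ replicate p h
      w≡ = cong (h ∷_) (trans (rotation-fixed⇒constant v fixed) (cong (λ k → replicate k h) (suc-injective |w|)))
      h^p : h ^ p ≡ ε
      h^p = trans (sym (product-replicate p h)) (trans (cong product (sym w≡)) product≡ε)

    constant-balanced : ∀ {h} → h ∈ Ls → h ^ p ≡ ε → Balanced (replicate p h)
    constant-balanced {h} h∈ h^p = length-replicate p , replicate⁺ p h∈ , trans (product-replicate p h) h^p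

    length-fixed-balanced : length (Fix balanced) ≡ length (Solutions Ls)
    length-fixed-balanced =
      trans (same-length (Unique.filter⁺ fixed? (PeriodicSet.unique Balanced-periodic))
                         (Unique.map⁺ replicate-injective (Unique.filter⁺ solution? unique)) constant const⇒fixed)
            (length-map (replicate p) (Solutions Ls))
      where
      replicate-injective : ∀ {x y} → replicate p x ≡ replicate p y → x ≡ y
      replicate-injective refl = refl
      constant : ∀ {w} → w ∈ Fix balanced → w ∈ map (replicate p) (Solutions Ls)
      constant w∈ with ∈-filter⁻ fixed? {xs = balanced} w∈
      ... | w∈balanced , fixed with fixed-balanced (∈balanced⁻ w∈balanced) fixed
      ... | h , refl , h∈ , h^p = ∈-map⁺ (replicate p) (∈-filter⁺ solution? h∈ h^p)
      const⇒fixed : ∀ {w} → w ∈ map (replicate p) (Solutions Ls) → w ∈ Fix balanced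
      const⇒fixed w∈ with ∈-map⁻ (replicate p) w∈
      ... | h , h∈ , refl with ∈-filter⁻ solution? {xs = Ls} h∈
      ... | h∈Ls , h^p = ∈-filter⁺ fixed? (∈balanced⁺ (constant-balanced h∈Ls h^p)) (rotate-replicate q h)

    cauchy : p ∣ length Ls → p ∣ length (Solutions Ls)
    cauchy p∣|L| with orbit-counting Balanced-periodic
    ... | m , |balanced|≡ = ∣m+n∣m⇒∣n (subst (p ∣_) |balanced|≡′ p∣|balanced|) (n∣m*n m)
      where
      |balanced|≡′ : length balanced ≡ m * p + length (Solutions Ls)
      |balanced|≡′ = trans |balanced|≡ (trans (cong (_+ m * p) length-fixed-balanced) (+-comm _ (m * p)))
      p∣|balanced| : p ∣ length balanced
      p∣|balanced| = subst (p ∣_) (sym (trans (length-map complete (tuples q)) (length-tuples q)))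
                       (prime-divides-power p-prime p∣|L|)

    -- Cauchy's theorem: besides ε the solutions of x ^ p = ε (at least p ≥ 2
    -- of them) contain an element of order p
    element-of-order-p : p ∣ length Ls → ∃ λ x → x ∈ Ls × OrderP x
    element-of-order-p p∣|L| with other-than _≟_ ε (Unique.filter⁺ solution? unique) 2≤|Sol|
      where
      ε∈Sol : ε ∈ Solutions Ls
      ε∈Sol = ∈-filter⁺ solution? ε∈ (ε^ p)
      2≤|Sol| : 2 ≤ length (Solutions Ls)
      2≤|Sol| = ≤-trans (nonTrivial⇒n>1 p {{prime⇒nonTrivial p-prime}})
                        (∣⇒≤ {{>-nonZero (∈-length ε∈Sol)}} (cauchy p∣|L|))
    ... | x , x∈Sol , x≢ε with ∈-filter⁻ solution? {xs = Ls} x∈Sol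
    ...   | x∈L , x^p = x , x∈L , x^p , x≢ε

members : ∀ {n} → Subset n → List (Fin n)
members {n} S = filter (_∈? S) (allFin n)

members-unique : ∀ {n} (S : Subset n) → Unique (members S)
members-unique {n} S = Unique.filter⁺ (_∈? S) (Unique.allFin⁺ n)

∈members⁺ : ∀ {n} {S : Subset n} {x} → x ∈ₛ S → x ∈ members S
∈members⁺ {S = S} x∈S = ∈-filter⁺ (_∈? S) (∈-allFin _) x∈S

∈members⁻ : ∀ {n} {S : Subset n} {x} → x ∈ members S → x ∈ₛ S
∈members⁻ {n} {S} x∈ = proj₂ (∈-filter⁻ (_∈? S) {xs = allFin n} x∈)

count-suc : ∀ {m n} (b : Bool) (S : Subset n) (f : Fin m → Fin n) →
  length (filter (_∈? (b ∷ S)) (tabulateᴸ (λ i → suc (f i)))) ≡ length (filter (_∈? S) (tabulateᴸ f))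
count-suc {zero}  b S f = refl
count-suc {suc m} b S f with does (f zero ∈? S)
... | true  = cong suc (count-suc b S (λ i → f (suc i)))
... | false = count-suc b S (λ i → f (suc i))

∣S∣≡length-members : ∀ {n} (S : Subset n) → ∣ S ∣ ≡ length (members S)
∣S∣≡length-members []            = refl
∣S∣≡length-members (inside ∷ S)  = cong suc (trans (∣S∣≡length-members S) (sym (count-suc inside S (λ i → i))))
∣S∣≡length-members (outside ∷ S) = trans (∣S∣≡length-members S) (sym (count-suc outside S (λ i → i)))

⊆-with-equal-size : ∀ {n} {H K : Subset n} → H ⊆ K → ∣ H ∣ ≡ ∣ K ∣ → K ≡ H
⊆-with-equal-size {H = H} {K} H⊆K |H|≡|K| with H ⊂? K
... | yes H⊂K = ⊥-elim (<-irrefl |H|≡|K| (p⊂q⇒∣p∣<∣q∣ H⊂K))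
... | no  H⊄K = ⊆-antisym K⊆H H⊆K
  where
  K⊆H : K ⊆ H
  K⊆H {x} x∈K with x ∈? H
  ... | yes x∈H = x∈H
  ... | no  x∉H = ⊥-elim (H⊄K (H⊆K , x , x∈K , x∉H))

subsetOf : ∀ {n} {P : Fin n → Set} → (∀ x → Dec (P x)) → Subset n
subsetOf P? = tabulate (λ x → does (P? x))

∈subsetOf⁺ : ∀ {n} {P : Fin n → Set} (P? : ∀ x → Dec (P x)) {x} → P x → x ∈ₛ subsetOf P?
∈subsetOf⁺ P? {x} Px = lookup⇒[]= x (subsetOf P?) (trans (lookup∘tabulate (λ y → does (P? y)) x) (dec-true (P? x) Px))

∈subsetOf⁻ : ∀ {n} {P : Fin n → Set} (P? : ∀ x → Dec (P x)) {x} → x ∈ₛ subsetOf P? → P x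
∈subsetOf⁻ P? {x} x∈ = witness (P? x) (trans (sym (lookup∘tabulate (λ y → does (P? y)) x)) ([]=⇒lookup x∈))
  where
  witness : ∀ {A : Set} (d : Dec A) → does d ≡ true → A
  witness (yes a) _ = a

module SubgroupFacts {n : ℕ} (G : FinGroup n) where
  open Powers G

  powers-∈ : ∀ {K} → IsSubgroup G K → ∀ {x} → x ∈ₛ K → ∀ k → x ^ k ∈ₛ K
  powers-∈ (ε∈K , _      , _) x∈K zero    = ε∈K
  powers-∈ K-subgroup@(_ , ∙-closed , _) x∈K (suc k) = ∙-closed _ _ x∈K (powers-∈ K-subgroup x∈K k)

  cyclic-⊆ : ∀ {K} → IsSubgroup G K → ∀ {x y} → x ∈ₛ K → y ∈⟨ x ⟩ → y ∈ₛ K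
  cyclic-⊆ K-subgroup x∈K (k , refl) = powers-∈ K-subgroup x∈K k

  members-subgroup : ∀ {K} → IsSubgroup G K → IsFiniteSubgroup G (members K)
  members-subgroup {K} (ε∈K , ∙-closed , ⁻¹-closed) = record
    { unique    = members-unique K
    ; ε∈        = ∈members⁺ ε∈K
    ; ∙-closed  = λ x∈ y∈ → ∈members⁺ (∙-closed _ _ (∈members⁻ x∈) (∈members⁻ y∈))
    ; ⁻¹-closed = λ x∈ → ∈members⁺ (⁻¹-closed _ (∈members⁻ x∈))
    }

module CyclicSubgroup {n : ℕ} (G : FinGroup n) (q : ℕ) (p-prime : Prime (suc q)) where
  open Powers G
  open PrimeOrder G q p-prime

  module _ {x : Fin n} (ox : OrderP x) where
    ⟨x⟩ₛ : Subset n
    ⟨x⟩ₛ = subsetOf (inPowers? x)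

    ∈⟨x⟩ₛ⁺ : ∀ {y} → y ∈⟨ x ⟩ → y ∈ₛ ⟨x⟩ₛ
    ∈⟨x⟩ₛ⁺ y∈ = ∈subsetOf⁺ (inPowers? x) (∈⟨⟩⇒InPowers (proj₁ ox) y∈)

    ∈⟨x⟩ₛ⁻ : ∀ {y} → y ∈ₛ ⟨x⟩ₛ → y ∈⟨ x ⟩
    ∈⟨x⟩ₛ⁻ y∈ with ∈subsetOf⁻ (inPowers? x) y∈
    ... | i , y≡xⁱ = toℕ i , y≡xⁱ

    cyclic-subgroup : IsSubgroup G ⟨x⟩ₛ
    cyclic-subgroup = ∈⟨x⟩ₛ⁺ (0 , refl) , ∙-closed , ⁻¹-closed
      where
      ∙-closed : ∀ y z → y ∈ₛ ⟨x⟩ₛ → z ∈ₛ ⟨x⟩ₛ → (y ∙ z) ∈ₛ ⟨x⟩ₛ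
      ∙-closed y z y∈ z∈ with ∈⟨x⟩ₛ⁻ y∈ | ∈⟨x⟩ₛ⁻ z∈
      ... | i , refl | j , refl = ∈⟨x⟩ₛ⁺ (i + j , sym (^-+ x i j))
      -- y ⁻¹ = y ^ q is again a power of x
      ⁻¹-closed : ∀ y → y ∈ₛ ⟨x⟩ₛ → (y ⁻¹) ∈ₛ ⟨x⟩ₛ
      ⁻¹-closed y y∈ with ∈⟨x⟩ₛ⁻ y∈
      ... | i , refl = ∈⟨x⟩ₛ⁺ (∈⟨⟩-trans (q , inverse-as-power (^-annihilates-powers x p (proj₁ ox) i)) (i , refl))

    ∣⟨x⟩ₛ∣≡p : ∣ ⟨x⟩ₛ ∣ ≡ p
    ∣⟨x⟩ₛ∣≡p = trans (∣S∣≡length-members ⟨x⟩ₛ)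
      (trans (same-length (members-unique ⟨x⟩ₛ) (powers-unique ox)
               (λ y∈ → proj₁ InPowers⇔∈powers (∈subsetOf⁻ (inPowers? x) (∈members⁻ y∈)))
               (λ y∈ → ∈members⁺ (∈subsetOf⁺ (inPowers? x) (proj₂ InPowers⇔∈powers y∈))))
             (length-powers x))

module UniqueSubgroup {n : ℕ} (G : FinGroup n) (q : ℕ) (p-prime : Prime (suc q)) (p∣n : suc q ∣ n)
                      (c : Fin n → Fin n → Fin 2) (rainbow : IsRainbowColouring G 2 c) where
  open Powers G
  open PrimeOrder G q p-prime
  open IndependentElements G q p-prime c rainbow using (no-three-independent)
  open McKay G q p-prime using (cauchy; element-of-order-p)
  open SubgroupFacts G using (cyclic-⊆; members-subgroup)
  open CyclicSubgroup G q p-prime using (⟨x⟩ₛ; ∈⟨x⟩ₛ⁻; cyclic-subgroup; ∣⟨x⟩ₛ∣≡p)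

  whole-group : IsFiniteSubgroup G (allFin n)
  whole-group = record
    { unique    = Unique.allFin⁺ n
    ; ε∈        = ∈-allFin ε
    ; ∙-closed  = λ _ _ → ∈-allFin _
    ; ⁻¹-closed = λ _ → ∈-allFin _
    }

  p∣|G| : p ∣ length (allFin n)
  p∣|G| = subst (p ∣_) (sym (length-allFin n)) p∣n

  -- If b ∉⟨ a ⟩, the solutions of x ^ p = ε are the p powers of a and the
  -- q nontrivial powers of b (any other one would be a third independent
  -- element), so p would divide p + q.
  module TwoIndependent {a b : Fin n} (oa : OrderP a) (ob : OrderP b) (b∉⟨a⟩ : ¬ b ∈⟨ a ⟩) where
    nontrivial-powers : List (Fin n)
    nontrivial-powers = map (λ i → b ^ toℕ (suc i)) (allFin q)

    length-nontrivial-powers : length nontrivial-powers ≡ q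
    length-nontrivial-powers = trans (length-map (λ i → b ^ toℕ (suc i)) (allFin q)) (length-allFin q)

    nontrivial-powers-unique : Unique nontrivial-powers
    nontrivial-powers-unique = Unique.map⁺ (λ e → Fin-suc-injective (powers-injective ob e)) (Unique.allFin⁺ q)

    disjoint : ∀ {x} → ¬ (x ∈ powers a × x ∈ nontrivial-powers)
    disjoint (x∈⟨a⟩ , x∈nontrivial) with proj₂ InPowers⇔∈powers x∈⟨a⟩
                                       | ∈-map⁻ (λ i → b ^ toℕ (suc i)) {xs = allFin q} x∈nontrivial
    ... | i , x≡aⁱ | j , _ , refl = b∉⟨a⟩ (∈⟨⟩-trans (generates-back (proj₁ ob) (toℕ (suc j) , refl) nontrivial)
                                                     (toℕ i , x≡aⁱ))
      where
      nontrivial : ¬ b ^ toℕ (suc j) ≡ ε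
      nontrivial e with powers-injective ob {suc j} {zero} e
      ... | ()

    split : ∀ {x} → x ∈ Solutions (allFin n) → x ∈ powers a ++ nontrivial-powers
    split {x} x∈ with inPowers? a x
    ... | yes x∈⟨a⟩ = ∈-++⁺ˡ (proj₁ InPowers⇔∈powers x∈⟨a⟩)
    ... | no  x∉⟨a⟩ with inPowers? b x
    ...   | yes (zero  , x≡ε) = ⊥-elim (x∉⟨a⟩ (zero , x≡ε))
    ...   | yes (suc i , refl) = ∈-++⁺ʳ (powers a) (∈-map⁺ (λ i → b ^ toℕ (suc i)) (∈-allFin i))
    ...   | no  x∉⟨b⟩ = ⊥-elim (no-three-independent oa ob ox b∉⟨a⟩
                                  (∉⟨⟩-from-InPowers (proj₁ oa) x∉⟨a⟩) (∉⟨⟩-from-InPowers (proj₁ ob) x∉⟨b⟩))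
      where
      ox : OrderP x
      ox = proj₂ (∈-filter⁻ solution? {xs = allFin n} x∈) , λ x≡ε → x∉⟨a⟩ (zero , x≡ε)

    unsplit : ∀ {x} → x ∈ powers a ++ nontrivial-powers → x ∈ Solutions (allFin n)
    unsplit {x} x∈ = ∈-filter⁺ solution? (∈-allFin x) (power-solution (∈-++⁻ (powers a) x∈))
      where
      power-solution : x ∈ powers a ⊎ x ∈ nontrivial-powers → x ^ p ≡ ε
      power-solution (inj₁ x∈⟨a⟩) with proj₂ InPowers⇔∈powers x∈⟨a⟩
      ... | i , refl = ^-annihilates-powers a p (proj₁ oa) (toℕ i)
      power-solution (inj₂ x∈nontrivial) with ∈-map⁻ (λ i → b ^ toℕ (suc i)) {xs = allFin q} x∈nontrivial
      ... | i , _ , refl = ^-annihilates-powers b p (proj₁ ob) (toℕ (suc i))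

    length-solutions : length (Solutions (allFin n)) ≡ p + q
    length-solutions =
      trans (same-length (Unique.filter⁺ solution? (Unique.allFin⁺ n))
                         (Unique.++⁺ (powers-unique oa) nontrivial-powers-unique disjoint) split unsplit)
            (trans (length-++ (powers a)) (cong₂ _+_ (length-powers a) length-nontrivial-powers))

    impossible : ⊥
    impossible = ≤⇒≯ (∣⇒≤ {{>-nonZero 0<q}} p∣q) (n<1+n q)
      where
      0<q : 0 < q
      0<q = s≤s⁻¹ (nonTrivial⇒n>1 p {{prime⇒nonTrivial p-prime}})
      p∣q : p ∣ q
      p∣q = ∣m+n∣m⇒∣n (subst (p ∣_) length-solutions (cauchy whole-group p∣|G|)) ∣-refl

  same-cyclic-subgroup : ∀ {a b} → OrderP a → OrderP b → b ∈⟨ a ⟩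
  same-cyclic-subgroup {a} {b} oa ob with inPowers? a b
  ... | yes (i , b≡aⁱ) = toℕ i , b≡aⁱ
  ... | no  b∉⟨a⟩ = ⊥-elim (TwoIndependent.impossible oa ob (∉⟨⟩-from-InPowers (proj₁ oa) b∉⟨a⟩))

  -- ⟨ x ⟩ for any x of order p (Cauchy) is a subgroup of order p; any other
  -- subgroup K of order p contains some y of order p (Cauchy in K), hence
  -- x ∈⟨ y ⟩ and ⟨ x ⟩ ⊆ K, so K = ⟨ x ⟩ as both have p elements
  unique-subgroup : UniqueSubgroupOfOrder G p
  unique-subgroup with element-of-order-p whole-group p∣|G|
  ... | x , _ , ox = ⟨x⟩ₛ ox , (cyclic-subgroup ox , ∣⟨x⟩ₛ∣≡p ox) , only-one
    where
    only-one : ∀ K → IsSubgroup G K → ∣ K ∣ ≡ p → K ≡ ⟨x⟩ₛ ox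
    only-one K K-subgroup |K|≡p with element-of-order-p (members-subgroup K-subgroup) p∣|K|
      where
      p∣|K| : p ∣ length (members K)
      p∣|K| = subst (p ∣_) (trans (sym |K|≡p) (∣S∣≡length-members K)) ∣-refl
    ... | y , y∈K , oy = ⊆-with-equal-size ⟨x⟩⊆K (trans (∣⟨x⟩ₛ∣≡p ox) (sym |K|≡p))
      where
      x∈K : x ∈ₛ K
      x∈K = cyclic-⊆ K-subgroup (∈members⁻ y∈K) (same-cyclic-subgroup oy ox)
      ⟨x⟩⊆K : ⟨x⟩ₛ ox ⊆ K
      ⟨x⟩⊆K z∈ = cyclic-⊆ K-subgroup x∈K (∈⟨x⟩ₛ⁻ ox z∈)

-- rc(Γ_G) = 2 provides a rainbow 2-colouring;
-- p = 0 is not prime and p = q + 1 is the case treated above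
lemma2p6 : (n : ℕ) (G : FinGroup n) (p : ℕ) → Prime p → p ∣ n →
    RainbowConnectionNumber G 2 → UniqueSubgroupOfOrder G p
lemma2p6 n G zero    p-prime _   _                   = ⊥-elim (¬prime[0] p-prime)
lemma2p6 n G (suc q) p-prime p∣n ((c , rainbow) , _) = UniqueSubgroup.unique-subgroup G q p-prime p∣n c rainbow
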